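{- Let $r\geq 2$ be an integer and let $G$ be a bipartite graph with maximum degree $\Delta(G)=2r-1$ such that $d_G(v)\in\{1,2,2r-2,2r-1\}$ for every $v\in V(G)$. Then $G$ is cyclically interval colorable and $w_c(G)\leq 2r$.
   Context: All graphs are finite and undirected; multiple edges are allowed, loops are not. A proper $t$-edge coloring of $G$ is a map $\alpha:E(G)\to\{1,\dots,t\}$ with $\alpha(e)\neq\alpha(e')$ for adjacent edges $e,e'$; $S(v,\alpha)$ is the set of colors on edges incident to $v$. A proper $t$-edge coloring $\alpha$ is a cyclic interval $t$-coloring if for every vertex $v$, either $S(v,\alpha)$ or $\{1,\dots,t\}\setminus S(v,\alpha)$ is a set of consecutive integers. A graph is cyclically interval colorable if it has a cyclic interval $t$-coloring for some positive integer $t$, and then $w_c(G)$ denotes the least such $t$. -}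

module Defs where

open import Data.Nat using (ℕ; zero; suc; _+_; _≤_; _∸_)
open import Data.Fin using (Fin)
open import Data.Fin.Properties using (_≟_)
open import Data.Bool using (Bool)
open import Data.Product using (Σ; ∃; ∃-syntax; _×_; _,_; proj₁; proj₂)
open import Data.Sum using (_⊎_)
open import Data.List using (List; allFin; map)
open import Data.Nat.ListAction using (sum)
open import Relation.Nullary using (¬_; Dec; yes; no)
open import Relation.Binary.PropositionalEquality using (_≡_; _≢_)
open import Function.Bundles using (_⇔_)

-- A finite multigraph (no loops) with vertex set Fin n and edge set Fin m.
-- Multiple edges are allowed since distinct edge indices may have the same ends.
record Graph : Set where
  field
    n     : ℕ
    m     : ℕ
    ends  : Fin m → Fin n × Fin n
    noLoop : (e : Fin m) → proj₁ (ends e) ≢ proj₂ (ends e)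

open Graph public

Incident : (G : Graph) → Fin (m G) → Fin (n G) → Set
Incident G e v = (proj₁ (ends G e) ≡ v) ⊎ (proj₂ (ends G e) ≡ v)

-- 1 if e is incident to v, else 0 (loops are excluded, so each edge counts once)
incidence : (G : Graph) → Fin (m G) → Fin (n G) → ℕ
incidence G e v with proj₁ (ends G e) ≟ v | proj₂ (ends G e) ≟ v
... | yes _ | _     = 1
... | no _  | yes _ = 1
... | no _  | no _  = 0

degree : (G : Graph) → Fin (n G) → ℕ
degree G v = sum (map (λ e → incidence G e v) (allFin (m G)))

Bipartite : Graph → Set
Bipartite G = Σ (Fin (n G) → Bool) λ side →
  (e : Fin (m G)) → side (proj₁ (ends G e)) ≢ side (proj₂ (ends G e))

Adjacent : (G : Graph) → Fin (m G) → Fin (m G) → Set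
Adjacent G e e' = (e ≢ e') × ∃[ v ] (Incident G e v × Incident G e' v)

ProperColoring : (G : Graph) → ℕ → (Fin (m G) → ℕ) → Set
ProperColoring G t α =
  ((e : Fin (m G)) → (1 ≤ α e) × (α e ≤ t)) ×
  ((e e' : Fin (m G)) → Adjacent G e e' → α e ≢ α e')

S : (G : Graph) → (Fin (m G) → ℕ) → Fin (n G) → ℕ → Set
S G α v c = ∃[ e ] (Incident G e v × α e ≡ c)

Consecutive : (ℕ → Set) → Set
Consecutive P = ∃[ a ] ∃[ b ] ((c : ℕ) → P c ⇔ ((a ≤ c) × (c ≤ b)))

Complement : ℕ → (ℕ → Set) → ℕ → Set
Complement t P c = ((1 ≤ c) × (c ≤ t)) × ¬ P c

CyclicIntervalColoring : (G : Graph) → ℕ → (Fin (m G) → ℕ) → Set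
CyclicIntervalColoring G t α =
  ProperColoring G t α ×
  ((v : Fin (n G)) → Consecutive (S G α v) ⊎ Consecutive (Complement t (S G α v)))

-- G has a cyclic interval t-colouring for some t ≥ 1 with t ≤ k,
-- i.e. G is cyclically interval colourable and w_c(G) ≤ k
CyclicallyIntervalColorableWithin : Graph → ℕ → Set
CyclicallyIntervalColorableWithin G k =
  ∃[ t ] ((1 ≤ t) × (t ≤ k) × ∃[ α ] CyclicIntervalColoring G t α)

module Submission where

open import Defs
open import Data.Nat using (ℕ; zero; suc; _<_; _≤_; z≤n; s≤s; _+_; _*_; _∸_; ⌊_/2⌋; _<?_)
import Data.Nat as ℕ
open import Data.Nat.Properties
  using (≤-refl; ≤-trans; <-≤-trans; ≤-antisym; ≤-pred; ≤-reflexive; <⇒≢; <-irrefl; n<1+n; n≤1+n; ≮⇒≥;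
         m≤n⇒m<n∨m≡n; n<1⇒n≡0; suc-injective; +-suc; *-suc; *-comm; +-monoʳ-<; +-mono-≤; +-mono-<-≤;
         +-mono-≤-<; +-cancelˡ-≡; ⌊n/2⌋-mono)
open import Data.Nat.DivMod using (_mod_; m<n⇒m%n≡m)
open import Data.Nat.ListAction using (sum)
open import Data.Fin using (Fin; zero; suc; toℕ; fromℕ; fromℕ<; combine)
import Data.Fin
open import Data.Fin.Properties
  using (_≟_; toℕ-injective; toℕ<n; toℕ-fromℕ; toℕ-fromℕ<; pigeonhole; ¬∀⟶∃¬; combine-injective;
         combine-surjective; toℕ-combine)
import Data.Fin.Properties as Fin
open import Data.Bool using (Bool; true; false; not)
open import Data.Bool.Properties using (¬-not; not-¬; not-injective)
import Data.Bool.Properties as Bool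
open import Data.Maybe using (Maybe; just; nothing)
open import Data.Maybe.Properties using (just-injective) renaming (≡-dec to ≡-decᴹ)
open import Data.Product using (∃; ∃₂; ∃-syntax; _×_; _,_; proj₁; proj₂)
import Data.Product.Properties as Product
open import Data.Sum using (_⊎_; inj₁; inj₂; [_,_]′) renaming (map to map⊎)
import Data.Sum.Properties as Sum
open import Data.Empty using (⊥; ⊥-elim)
open import Data.List using (List; []; _∷_; map; allFin; tabulate; _++_; cartesianProduct)
open import Data.List.Properties using (map-tabulate)
open import Data.List.Relation.Unary.Any using (Any; here; there; any?; satisfied)
open import Data.List.Membership.Propositional using (_∈_; _∉_; lose)
open import Data.List.Membership.Propositional.Properties
  using (∈-++⁺ˡ; ∈-++⁺ʳ; ∈-map⁺; ∈-cartesianProduct⁺; ∈-allFin)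
open import Function using (_∘_)
open import Function.Bundles using (mk⇔)
open import Relation.Nullary using (¬_; Dec; yes; no)
open import Relation.Nullary.Decidable using (_×-dec_)
open import Relation.Binary.Definitions using (DecidableEquality)
open import Relation.Binary.PropositionalEquality using (_≡_; _≢_; refl; sym; trans; cong; cong₂; subst)

-- Number the edges at each vertex and group them into consecutive pairs. A proper
-- 2-edge-colouring (König) of the graph whose vertices are these pairs splits every vertex v
-- into two halves with one edge of each full pair. Completing every half with dummy edges to
-- one edge in each of r slots and colouring this bipartite graph properly with r classes
-- (König again) uses every class at every half; so a class has at most one edge of G in each
-- half of v, and a third König colouring with two bits separates these. Class i and bit b
-- give colour 2i + b + 1. At a vertex of degree 2r − 2 the only class absent is that of the
-- dummy joining its halves, i.e. a pair of consecutive colours; at degree 2r − 1 only one colour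
-- of the class of the pendant dummy is absent; at degree 2 both edges share a class.

data EndOf {X : Set} : X × X → X → Set where
  source : ∀ {a b} → EndOf (a , b) a
  target : ∀ {a b} → EndOf (a , b) b

Touches : {X E : Set} → (E → X × X) → E → X → Set
Touches ends e x = EndOf (ends e) x

ProperEdgeColouring : {X E C : Set} → (E → X × X) → (E → C) → Set
ProperEdgeColouring ends κ =
  ∀ {e e' x} → e ≢ e' → Touches ends e x → Touches ends e' x → κ e ≢ κ e'

-- König's edge-colouring theorem for bipartite multigraphs, proved by colouring the edges
-- one at a time with Kempe-chain swaps. Maximum degree ≤ k is expressed by an injective
-- labelling slot x of the edges at each vertex x with Fin k.
module Konig {X E : Set} (_≟ˣ_ : DecidableEquality X) (_≟ᵉ_ : DecidableEquality E)
  (edges : List E) (∈-edges : ∀ e → e ∈ edges)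
  (ends : E → X × X) (side : X → Bool)
  (bipartite : ∀ e → side (proj₁ (ends e)) ≢ side (proj₂ (ends e)))
  (k : ℕ) (slot : X → E → Fin k)
  (slot-injective : ∀ {x e e'} → Touches ends e x → Touches ends e' x →
                    slot x e ≡ slot x e' → e ≡ e') where

  open import Data.List.Membership.DecPropositional _≟ᵉ_ using (_∈?_)

  Partial : Set
  Partial = E → Maybe (Fin k)

  Proper : Partial → Set
  Proper c = ∀ {e e' x p} → e ≢ e' → Touches ends e x → Touches ends e' x →
             c e ≡ just p → c e' ≢ just p

  Missing : Partial → X → Fin k → Set
  Missing c x p = ∀ {e} → Touches ends e x → c e ≢ just p

  nothing≢just : ∀ {p : Fin k} → nothing ≢ just p
  nothing≢just ()

  PQ : Fin k → Fin k → Maybe (Fin k) → Set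
  PQ p q a = a ≡ just p ⊎ a ≡ just q

  PQ-swap : ∀ {p q a} → PQ p q a → PQ q p a
  PQ-swap (inj₁ a≡p) = inj₂ a≡p
  PQ-swap (inj₂ a≡q) = inj₁ a≡q

  touches? : ∀ e x → Dec (Touches ends e x)
  touches? e x with proj₁ (ends e) ≟ˣ x | proj₂ (ends e) ≟ˣ x
  ... | yes refl | _        = yes source
  ... | no _     | yes refl = yes target
  ... | no s≢x   | no t≢x   = no λ { source → s≢x refl ; target → t≢x refl }

  coloured? : ∀ (c : Partial) x p → Dec (∃ λ e → Touches ends e x × c e ≡ just p)
  coloured? c x p
    with any? (λ e → touches? e x ×-dec ≡-decᴹ (_≟_ {k}) (c e) (just p)) edges
  ... | yes found = yes (satisfied found)
  ... | no none   = no λ (e , t , ce) → none (lose (∈-edges e) (t , ce))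

  record OtherEnd (f : E) (z : X) : Set where
    field
      end      : X
      touches  : Touches ends f end
      opposite : side end ≢ side z
      only     : ∀ {x} → Touches ends f x → x ≡ z ⊎ x ≡ end

  other-end : ∀ {f z} → Touches ends f z → OtherEnd f z
  other-end {f} source = record
    { end = proj₂ (ends f) ; touches = target ; opposite = λ eq → bipartite f (sym eq)
    ; only = λ { source → inj₁ refl ; target → inj₂ refl } }
  other-end {f} target = record
    { end = proj₁ (ends f) ; touches = source ; opposite = bipartite f
    ; only = λ { source → inj₂ refl ; target → inj₁ refl } }

  recolour : Partial → E → Maybe (Fin k) → Partial
  recolour c f a e with e ≟ᵉ f
  ... | yes _ = a
  ... | no _  = c e

  recolour-≡ : ∀ c f a → recolour c f a f ≡ a
  recolour-≡ c f a with f ≟ᵉ f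
  ... | yes _  = refl
  ... | no f≢f = ⊥-elim (f≢f refl)

  recolour-≢ : ∀ c f a {e} → e ≢ f → recolour c f a e ≡ c e
  recolour-≢ c f a {e} e≢f with e ≟ᵉ f
  ... | yes e≡f = ⊥-elim (e≢f e≡f)
  ... | no _    = refl

  uncoloured-was : ∀ c f {e a} → recolour c f nothing e ≡ just a → c e ≡ just a
  uncoloured-was c f {e} ce with e ≟ᵉ f
  ... | yes _ = ⊥-elim (nothing≢just ce)
  ... | no _  = ce

  uncolour-proper : ∀ c f → Proper c → Proper (recolour c f nothing)
  uncolour-proper c f proper e≢e' t t' ce ce' =
    proper e≢e' t t' (uncoloured-was c f ce) (uncoloured-was c f ce')

  uncolour-missing : ∀ c f {x p} → Missing c x p → Missing (recolour c f nothing) x p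
  uncolour-missing c f missing t ce = missing t (uncoloured-was c f ce)

  -- Splitting on this instead of on _≟ᵉ_ keeps `with` from abstracting inside recolour.
  ≡-or-≢ : ∀ (e f : E) → e ≡ f ⊎ e ≢ f
  ≡-or-≢ e f with e ≟ᵉ f
  ... | yes e≡f = inj₁ e≡f
  ... | no e≢f  = inj₂ e≢f

  recoloured : ∀ (c : Partial) f s {p} → recolour c f (just s) f ≡ just p → s ≡ p
  recoloured c f s cf = just-injective (trans (sym (recolour-≡ c f (just s))) cf)

  not-recoloured : ∀ (c : Partial) f a {e b} → e ≢ f → recolour c f a e ≡ b → c e ≡ b
  not-recoloured c f a e≢f ce = trans (sym (recolour-≢ c f a e≢f)) ce

  colour-edge-proper : ∀ (c : Partial) f s → Proper c → (∀ {x} → Touches ends f x → Missing c x s) →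
                       Proper (recolour c f (just s))
  colour-edge-proper c f s proper missing {e} {e'} e≢e' t t' ce ce'
    with ≡-or-≢ e f | ≡-or-≢ e' f
  ... | inj₁ refl | inj₁ refl = e≢e' refl
  ... | inj₁ refl | inj₂ e'≢f =
    missing t t' (trans (not-recoloured c f _ e'≢f ce') (cong just (sym (recoloured c f s ce))))
  ... | inj₂ e≢f  | inj₁ refl =
    missing t' t (trans (not-recoloured c f _ e≢f ce) (cong just (sym (recoloured c f s ce'))))
  ... | inj₂ e≢f  | inj₂ e'≢f =
    proper e≢e' t t' (not-recoloured c f _ e≢f ce) (not-recoloured c f _ e'≢f ce')

  weight : Maybe (Fin k) → ℕ
  weight nothing  = 0
  weight (just _) = 1

  #coloured : Partial → ℕ
  #coloured c = sum (map (λ e → weight (c e)) edges)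

  uncolour-decreases : ∀ c f {s} → c f ≡ just s → #coloured (recolour c f nothing) < #coloured c
  uncolour-decreases c f cf = sum-< edges (lose (∈-edges f) refl)
    where
    w≤ : ∀ e → weight (recolour c f nothing e) ≤ weight (c e)
    w≤ e with e ≟ᵉ f
    ... | yes _ = z≤n
    ... | no _  = ≤-refl
    sum-≤ : ∀ es → sum (map (λ e → weight (recolour c f nothing e)) es) ≤
                   sum (map (λ e → weight (c e)) es)
    sum-≤ []       = z≤n
    sum-≤ (e ∷ es) = +-mono-≤ (w≤ e) (sum-≤ es)
    sum-< : ∀ es → Any (f ≡_) es →
            sum (map (λ e → weight (recolour c f nothing e)) es) < sum (map (λ e → weight (c e)) es)
    sum-< (e ∷ es) (here refl) rewrite recolour-≡ c f nothing | cf = +-mono-<-≤ (s≤s z≤n) (sum-≤ es)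
    sum-< (e ∷ es) (there f∈) = +-mono-≤-< (w≤ e) (sum-< es f∈)

  -- Result of interchanging p and q along the p/q-alternating path that starts at z
  -- with an edge coloured q.
  record Swapped (c : Partial) (p q : Fin k) (z : X) : Set where
    field
      colouring            : Partial
      proper               : Proper colouring
      q-missing            : Missing colouring z q
      uncoloured-preserved : ∀ {e} → c e ≡ nothing → colouring e ≡ nothing
      uncoloured-reflected : ∀ {e} → colouring e ≡ nothing → c e ≡ nothing
      PQ-reflected         : ∀ {e} → PQ p q (colouring e) → PQ p q (c e)
      q-missing-across     : ∀ {u} → side u ≢ side z → Missing c u q → Missing colouring u q
      p-missing-beside     : ∀ {u} → u ≢ z → side u ≡ side z → Missing c u p → Missing colouring u p

  unswapped : ∀ (c : Partial) p q z → Proper c → Missing c z q → Swapped c p q z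
  unswapped c p q z proper q-missing = record
    { colouring = c ; proper = proper ; q-missing = q-missing
    ; uncoloured-preserved = λ ce → ce ; uncoloured-reflected = λ ce → ce
    ; PQ-reflected = λ pq → pq ; q-missing-across = λ _ m → m ; p-missing-beside = λ _ _ m → m }

  uncolour-makes-missing : ∀ {c f w q} → Proper c → Touches ends f w → c f ≡ just q →
                           Missing (recolour c f nothing) w q
  uncolour-makes-missing {c} {f} proper tf cf {e} t ce = proper e≢f t tf (uncoloured-was c f ce) cf
    where
    e≢f : e ≢ f
    e≢f refl = nothing≢just (trans (sym (recolour-≡ c f nothing)) ce)

  -- The first edge f of the path (coloured q at z) is uncoloured, R has swapped the rest of
  -- the path, which starts with a p-edge at the other end w of f, and f is recoloured p.
  module ExtendSwap {c : Partial} {p q : Fin k} {z : X} {f : E}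
    (proper : Proper c) (p-missing : Missing c z p) (tf : Touches ends f z) (cf : c f ≡ just q)
    (R : Swapped (recolour c f nothing) q p (OtherEnd.end (other-end tf))) where

    open OtherEnd (other-end tf) renaming (end to w)
    module R = Swapped R

    p≢q : p ≢ q
    p≢q refl = p-missing tf cf

    c' : Partial
    c' = recolour R.colouring f (just p)

    old : ∀ {e a} → e ≢ f → c' e ≡ a → R.colouring e ≡ a
    old = not-recoloured R.colouring f (just p)

    new : c' f ≡ just p
    new = recolour-≡ R.colouring f (just p)

    p-missing-at-z : Missing R.colouring z p
    p-missing-at-z = R.q-missing-across (λ eq → opposite (sym eq)) (uncolour-missing c f p-missing)

    proper' : Proper c'
    proper' = colour-edge-proper R.colouring f p R.proper ends-missing
      where
      ends-missing : ∀ {x} → Touches ends f x → Missing R.colouring x p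
      ends-missing t with only t
      ... | inj₁ refl = p-missing-at-z
      ... | inj₂ refl = R.q-missing

    q-missing' : Missing c' z q
    q-missing' {e} t ce with ≡-or-≢ e f
    ... | inj₁ refl = p≢q (just-injective (trans (sym new) ce))
    ... | inj₂ e≢f with R.PQ-reflected (inj₁ (old e≢f ce))
    ...   | inj₁ c₀e≡q = proper e≢f t tf (uncoloured-was c f c₀e≡q) cf
    ...   | inj₂ c₀e≡p = p-missing t (uncoloured-was c f c₀e≡p)

    uncoloured-preserved' : ∀ {e} → c e ≡ nothing → c' e ≡ nothing
    uncoloured-preserved' {e} ce with ≡-or-≢ e f
    ... | inj₁ refl with () ← trans (sym ce) cf
    ... | inj₂ e≢f = trans (recolour-≢ R.colouring f (just p) e≢f)
                           (R.uncoloured-preserved (trans (recolour-≢ c f nothing e≢f) ce))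

    uncoloured-reflected' : ∀ {e} → c' e ≡ nothing → c e ≡ nothing
    uncoloured-reflected' {e} ce with ≡-or-≢ e f
    ... | inj₁ refl with () ← trans (sym ce) new
    ... | inj₂ e≢f = trans (sym (recolour-≢ c f nothing e≢f)) (R.uncoloured-reflected (old e≢f ce))

    PQ-reflected' : ∀ {e} → PQ p q (c' e) → PQ p q (c e)
    PQ-reflected' {e} pq with ≡-or-≢ e f
    ... | inj₁ refl = inj₂ cf
    ... | inj₂ e≢f = PQ-swap (map⊎ (uncoloured-was c f) (uncoloured-was c f)
                       (R.PQ-reflected (PQ-swap (map⊎ (old e≢f) (old e≢f) pq))))

    q-missing-across' : ∀ {u} → side u ≢ side z → Missing c u q → Missing c' u q
    q-missing-across' {u} u≁z missing {e} t ce with ≡-or-≢ e f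
    ... | inj₁ refl = p≢q (just-injective (trans (sym new) ce))
    ... | inj₂ e≢f = R.p-missing-beside u≢w (trans (¬-not u≁z) (sym (¬-not opposite)))
                       (uncolour-missing c f missing) t (old e≢f ce)
      where
      u≢w : u ≢ w
      u≢w refl = missing touches cf

    p-missing-beside' : ∀ {u} → u ≢ z → side u ≡ side z → Missing c u p → Missing c' u p
    p-missing-beside' {u} u≢z u∼z missing {e} t ce with ≡-or-≢ e f
    ... | inj₁ refl = [ u≢z , (λ { refl → opposite u∼z }) ]′ (only t)
    ... | inj₂ e≢f = R.q-missing-across (λ eq → opposite (trans (sym eq) u∼z))
                       (uncolour-missing c f missing) t (old e≢f ce)

    swapped : Swapped c p q z
    swapped = record
      { colouring = c' ; proper = proper' ; q-missing = q-missing'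
      ; uncoloured-preserved = uncoloured-preserved' ; uncoloured-reflected = uncoloured-reflected'
      ; PQ-reflected = PQ-reflected' ; q-missing-across = q-missing-across'
      ; p-missing-beside = p-missing-beside' }

  -- Recursion on the number of coloured edges, which drops when f is uncoloured.
  swap : ∀ fuel (c : Partial) → #coloured c < fuel → Proper c → ∀ p q z → Missing c z p → Swapped c p q z
  swap (suc fuel) c bound proper p q z p-missing with coloured? c z q
  ... | no no-q = unswapped c p q z proper (λ t ce → no-q (_ , t , ce))
  ... | yes (f , tf , cf) = ExtendSwap.swapped proper p-missing tf cf
    (swap fuel (recolour c f nothing) (<-≤-trans (uncolour-decreases c f cf) (≤-pred bound))
          (uncolour-proper c f proper) q p _
          (uncolour-makes-missing proper (OtherEnd.touches (other-end tf)) cf))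

  missing-colour : ∀ (c : Partial) {x e₀} → Touches ends e₀ x → c e₀ ≡ nothing → ∃ λ p → Missing c x p
  missing-colour c {x} {e₀} t₀ c₀ with ¬∀⟶∃¬ k _ (coloured? c x) not-all
    where
    -- k colours in use at x, together with the uncoloured e₀, would need k + 1 slots
    not-all : ¬ (∀ p → ∃ λ e → Touches ends e x × c e ≡ just p)
    not-all all = clash (pigeonhole (n<1+n k) slots)
      where
      touches : ∀ p → Touches ends (proj₁ (all p)) x
      touches p = proj₁ (proj₂ (all p))
      coloured : ∀ p → c (proj₁ (all p)) ≡ just p
      coloured p = proj₂ (proj₂ (all p))
      slots : Fin (suc k) → Fin k
      slots zero    = slot x e₀
      slots (suc p) = slot x (proj₁ (all p))
      clash : (∃₂ λ i j → i Data.Fin.< j × slots i ≡ slots j) → ⊥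
      clash (zero  , zero   , ()   , _)
      clash (suc _ , zero   , ()   , _)
      clash (zero  , suc p  , _    , eq) =
        nothing≢just (trans (sym c₀) (trans (cong c (slot-injective t₀ (touches p) eq)) (coloured p)))
      clash (suc p , suc p' , p<p' , eq) = Fin.<-irrefl (cong suc (just-injective (trans (sym (coloured p))
        (trans (cong c (slot-injective (touches p) (touches p') eq)) (coloured p'))))) p<p'
  ... | p , not-used = p , λ t ce → not-used (_ , t , ce)

  Coloured : Partial → E → Set
  Coloured c e = ∃ λ p → c e ≡ just p

  colour-edge : ∀ (c : Partial) e₀ → Proper c → c e₀ ≡ nothing →
                ∃ λ c' → Proper c' × Coloured c' e₀ × (∀ {e} → Coloured c e → Coloured c' e) ×
                         (∀ {e} → e ≢ e₀ → c e ≡ nothing → c' e ≡ nothing)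
  colour-edge c e₀ proper uncoloured =
    c' , proper' , (b , recolour-≡ S.colouring e₀ (just b)) , stays-coloured , stays-uncoloured
    where
    -- With a missing at one end and b at the other, swapping a and b from the first end
    -- makes b missing at both.
    a-missing = missing-colour c source uncoloured
    b-missing = missing-colour c target uncoloured
    b = proj₁ b-missing
    module S = Swapped (swap (suc (#coloured c)) c ≤-refl proper (proj₁ a-missing) b _ (proj₂ a-missing))
    c' : Partial
    c' = recolour S.colouring e₀ (just b)
    proper' : Proper c'
    proper' = colour-edge-proper S.colouring e₀ b S.proper λ
      { source → S.q-missing
      ; target → S.q-missing-across (λ eq → bipartite e₀ (sym eq)) (proj₂ b-missing) }
    stays-coloured : ∀ {e} → Coloured c e → Coloured c' e
    stays-coloured {e} (p , ce) with ≡-or-≢ e e₀ | S.colouring e in eq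
    ... | inj₁ refl | _       = b , recolour-≡ S.colouring e₀ (just b)
    ... | inj₂ e≢e₀ | just p' = p' , trans (recolour-≢ S.colouring e₀ (just b) e≢e₀) eq
    ... | inj₂ _    | nothing with () ← trans (sym ce) (S.uncoloured-reflected eq)
    stays-uncoloured : ∀ {e} → e ≢ e₀ → c e ≡ nothing → c' e ≡ nothing
    stays-uncoloured e≢e₀ ce = trans (recolour-≢ S.colouring e₀ (just b) e≢e₀) (S.uncoloured-preserved ce)

  colour-list : ∀ L → ∃ λ c → Proper c × (∀ {e} → e ∈ L → Coloured c e) ×
                              (∀ {e} → e ∉ L → c e ≡ nothing)
  colour-list [] = (λ _ → nothing) , (λ { _ _ _ () _ }) , (λ ()) , (λ _ → refl)
  colour-list (e₀ ∷ L) with colour-list L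
  ... | c , proper , coloured , uncoloured with e₀ ∈? L
  ...   | yes e₀∈L = c , proper , (λ { (here refl) → coloured e₀∈L ; (there e∈L) → coloured e∈L })
                   , (λ e∉ → uncoloured (e∉ ∘ there))
  ...   | no e₀∉L with colour-edge c e₀ proper (uncoloured e₀∉L)
  ...     | c' , proper' , coloured-e₀ , stays-coloured , stays-uncoloured =
              c' , proper' , (λ { (here refl) → coloured-e₀ ; (there e∈L) → stays-coloured (coloured e∈L) })
                 , (λ e∉ → stays-uncoloured (λ { refl → e∉ (here refl) }) (uncoloured (e∉ ∘ there)))

  konig : ∃ λ (κ : E → Fin k) → ProperEdgeColouring ends κ
  konig with colour-list edges
  ... | c , proper , coloured , _ = κ , λ e≢e' t t' κe≡κe' →
          proper e≢e' t t' (proj₂ (coloured (∈-edges _)))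
                 (trans (proj₂ (coloured (∈-edges _))) (cong just (sym κe≡κe')))
    where
    κ : E → Fin k
    κ e = proj₁ (coloured (∈-edges e))

-- Pairing of positions: position q belongs to pair ⌊ q /2⌋, in which it has index lowBit q.
lowBit : ℕ → Fin 2
lowBit zero          = zero
lowBit (suc zero)    = suc zero
lowBit (suc (suc q)) = lowBit q

⌊/2⌋-lowBit-injective : ∀ {p q} → ⌊ p /2⌋ ≡ ⌊ q /2⌋ → lowBit p ≡ lowBit q → p ≡ q
⌊/2⌋-lowBit-injective {zero}          {zero}          _  _ = refl
⌊/2⌋-lowBit-injective {suc zero}      {suc zero}      _  _ = refl
⌊/2⌋-lowBit-injective {suc (suc p)}   {suc (suc q)}   eq bit =
  cong (2 +_) (⌊/2⌋-lowBit-injective (suc-injective eq) bit)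
⌊/2⌋-lowBit-injective {zero}          {suc zero}      _  ()
⌊/2⌋-lowBit-injective {suc zero}      {zero}          _  ()
⌊/2⌋-lowBit-injective {zero}          {suc (suc _)}   ()
⌊/2⌋-lowBit-injective {suc zero}      {suc (suc _)}   ()
⌊/2⌋-lowBit-injective {suc (suc _)}   {zero}          ()
⌊/2⌋-lowBit-injective {suc (suc _)}   {suc zero}      ()

⌊2*n/2⌋≡n : ∀ n → ⌊ 2 * n /2⌋ ≡ n
⌊2*n/2⌋≡n zero    = refl
⌊2*n/2⌋≡n (suc n) = trans (cong ⌊_/2⌋ (*-suc 2 n)) (cong suc (⌊2*n/2⌋≡n n))

⌊1+2*n/2⌋≡n : ∀ n → ⌊ suc (2 * n) /2⌋ ≡ n
⌊1+2*n/2⌋≡n zero    = refl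
⌊1+2*n/2⌋≡n (suc n) = trans (cong (λ x → ⌊ suc x /2⌋) (*-suc 2 n)) (cong suc (⌊1+2*n/2⌋≡n n))

⌊/2⌋≡⇒ : ∀ q {n} → ⌊ q /2⌋ ≡ n → q ≡ 2 * n ⊎ q ≡ suc (2 * n)
⌊/2⌋≡⇒ zero          refl = inj₁ refl
⌊/2⌋≡⇒ (suc zero)    refl = inj₂ refl
⌊/2⌋≡⇒ (suc (suc q)) {suc n} eq =
  map⊎ (λ q≡ → trans (cong (2 +_) q≡) (sym (*-suc 2 n)))
       (λ q≡ → trans (cong (2 +_) q≡) (cong suc (sym (*-suc 2 n))))
       (⌊/2⌋≡⇒ q (suc-injective eq))

2*⌊/2⌋≤ : ∀ q {n} → ⌊ q /2⌋ ≡ n → 2 * n ≤ q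
2*⌊/2⌋≤ q {n} eq with ⌊/2⌋≡⇒ q eq
... | inj₁ q≡ = ≤-reflexive (sym q≡)
... | inj₂ q≡ = subst (2 * n ≤_) (sym q≡) (n≤1+n (2 * n))

2*m≤1+2*n⇒m≤n : ∀ {m n} → 2 * m ≤ suc (2 * n) → m ≤ n
2*m≤1+2*n⇒m≤n {m} {n} le =
  ≤-trans (≤-reflexive (sym (⌊2*n/2⌋≡n m))) (≤-trans (⌊n/2⌋-mono le) (≤-reflexive (⌊1+2*n/2⌋≡n n)))

even≢odd : ∀ m n → 2 * m ≢ suc (2 * n)
even≢odd zero    _       ()
even≢odd (suc m) zero    eq with () ← suc-injective (trans (sym (*-suc 2 m)) eq)
even≢odd (suc m) (suc n) eq =
  even≢odd m n (suc-injective (suc-injective (trans (sym (*-suc 2 m)) (trans eq (cong suc (*-suc 2 n))))))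

-- Pair j of a vertex of degree d consists of the positions 2j and 2j + 1 below d.
data PairStatus (d j : ℕ) : Set where
  complete : suc (2 * j) < d → PairStatus d j
  unpaired : d ≡ suc (2 * j) → PairStatus d j
  absent   : d ≤ 2 * j → PairStatus d j

pair-status : ∀ d j → PairStatus d j
pair-status d j with suc (2 * j) <? d | 2 * j <? d
... | yes lt | _     = complete lt
... | no ¬lt | yes lt = unpaired (≤-antisym (≮⇒≥ ¬lt) lt)
... | no _   | no ¬lt = absent (≮⇒≥ ¬lt)

2*[1+n]∸2≡2*n : ∀ n → 2 * suc n ∸ 2 ≡ 2 * n
2*[1+n]∸2≡2*n n = cong (_∸ 2) (*-suc 2 n)

2*[1+n]∸1≡1+2*n : ∀ n → 2 * suc n ∸ 1 ≡ suc (2 * n)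
2*[1+n]∸1≡1+2*n n = cong (_∸ 1) (*-suc 2 n)

other : Fin 2 → Fin 2
other zero       = suc zero
other (suc zero) = zero

other≢ : ∀ h → other h ≢ h
other≢ zero       ()
other≢ (suc zero) ()

≢other⇒≡ : ∀ h {h'} → h' ≢ other h → h' ≡ h
≢other⇒≡ zero       {zero}     _   = refl
≢other⇒≡ zero       {suc zero} h'≢ = ⊥-elim (h'≢ refl)
≢other⇒≡ (suc zero) {zero}     h'≢ = ⊥-elim (h'≢ refl)
≢other⇒≡ (suc zero) {suc zero} _   = refl

≢⇒other : ∀ h {h'} → h' ≢ h → h' ≡ other h
≢⇒other zero       {zero}     h'≢ = ⊥-elim (h'≢ refl)
≢⇒other zero       {suc zero} _   = refl
≢⇒other (suc zero) {zero}     _   = refl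
≢⇒other (suc zero) {suc zero} h'≢ = ⊥-elim (h'≢ refl)

≢⇒either : ∀ {a b : Fin 2} → a ≢ b → ∀ h → a ≡ h ⊎ b ≡ h
≢⇒either {zero}     {zero}     a≢b _          = ⊥-elim (a≢b refl)
≢⇒either {zero}     {suc zero} _   zero       = inj₁ refl
≢⇒either {zero}     {suc zero} _   (suc zero) = inj₂ refl
≢⇒either {suc zero} {zero}     _   zero       = inj₂ refl
≢⇒either {suc zero} {zero}     _   (suc zero) = inj₁ refl
≢⇒either {suc zero} {suc zero} a≢b _          = ⊥-elim (a≢b refl)

Fin-injective⇒surjective : ∀ {n} (f : Fin n → Fin n) → (∀ {i j} → f i ≡ f j → i ≡ j) →
                           ∀ y → ∃ λ i → f i ≡ y
Fin-injective⇒surjective {n} f injective y with pigeonhole (n<1+n n) g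
  where
  g : Fin (suc n) → Fin n
  g zero    = y
  g (suc i) = f i
... | zero  , zero  , ()  , _
... | suc _ , zero  , ()  , _
... | zero  , suc i , _   , y≡fi = i , sym y≡fi
... | suc i , suc j , i<j , fi≡fj = ⊥-elim (Fin.<-irrefl (cong suc (injective fi≡fj)) i<j)

Binary : ∀ {m} → (Fin m → ℕ) → Set
Binary f = ∀ i → f i ≡ 0 ⊎ f i ≡ 1

rank : ∀ {m} → (Fin m → ℕ) → Fin m → ℕ
rank f zero    = 0
rank f (suc i) = f zero + rank (f ∘ suc) i

rank<sum : ∀ {m} (f : Fin m → ℕ) {i} → f i ≡ 1 → rank f i < sum (tabulate f)
rank<sum f {zero}  fi≡1 rewrite fi≡1 = s≤s z≤n
rank<sum f {suc i} fi≡1 = +-monoʳ-< (f zero) (rank<sum (f ∘ suc) fi≡1)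

rank-injective : ∀ {m} (f : Fin m → ℕ) {i j} → f i ≡ 1 → f j ≡ 1 → rank f i ≡ rank f j → i ≡ j
rank-injective f {zero}  {zero}  _    _    _  = refl
rank-injective f {zero}  {suc _} fi≡1 _    eq rewrite fi≡1 with () ← eq
rank-injective f {suc _} {zero}  _    fj≡1 eq rewrite fj≡1 with () ← eq
rank-injective f {suc i} {suc j} fi≡1 fj≡1 eq =
  cong suc (rank-injective (f ∘ suc) fi≡1 fj≡1 (+-cancelˡ-≡ (f zero) _ _ eq))

rank-surjective : ∀ {m} (f : Fin m → ℕ) → Binary f → ∀ {p} → p < sum (tabulate f) →
                  ∃ λ i → f i ≡ 1 × rank f i ≡ p
rank-surjective {suc m} f binary {p} p< with binary zero
... | inj₁ f0≡0 rewrite f0≡0 with rank-surjective (f ∘ suc) (binary ∘ suc) p<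
...   | i , fi≡1 , rank≡p = suc i , fi≡1 , trans (cong (_+ rank (f ∘ suc) i) f0≡0) rank≡p
rank-surjective {suc m} f binary {zero} p< | inj₂ f0≡1 = zero , f0≡1 , refl
rank-surjective {suc m} f binary {suc p} p< | inj₂ f0≡1 rewrite f0≡1
  with rank-surjective (f ∘ suc) (binary ∘ suc) (≤-pred p<)
... | i , fi≡1 , rank≡p = suc i , fi≡1 , trans (cong (_+ rank (f ∘ suc) i) f0≡1) (cong suc rank≡p)

module EdgePositions (G : Graph) where

  Vertex Edge : Set
  Vertex = Fin (n G)
  Edge   = Fin (m G)

  incidence≡1 : ∀ {e v} → Incident G e v → incidence G e v ≡ 1
  incidence≡1 {e} {v} i with proj₁ (ends G e) ≟ v | proj₂ (ends G e) ≟ v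
  ... | yes _ | _     = refl
  ... | no _  | yes _ = refl
  ... | no s≢v | no t≢v = ⊥-elim ([ s≢v , t≢v ]′ i)

  incidence≡1⇒ : ∀ {e v} → incidence G e v ≡ 1 → Incident G e v
  incidence≡1⇒ {e} {v} eq with proj₁ (ends G e) ≟ v | proj₂ (ends G e) ≟ v
  ... | yes s≡v | _       = inj₁ s≡v
  ... | no _    | yes t≡v = inj₂ t≡v
  ... | no _    | no _    with () ← eq

  incidence-binary : ∀ v → Binary (λ e → incidence G e v)
  incidence-binary v e with proj₁ (ends G e) ≟ v | proj₂ (ends G e) ≟ v
  ... | yes _ | _     = inj₂ refl
  ... | no _  | yes _ = inj₂ refl
  ... | no _  | no _  = inj₁ refl

  degree≡sum : ∀ v → degree G v ≡ sum (tabulate (λ e → incidence G e v))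
  degree≡sum v = cong sum (map-tabulate (λ e → e) (λ e → incidence G e v))

  -- Kept abstract: unfolding the sum in degree G or the recursion in rank makes every
  -- later `with` normalise huge terms.
  abstract
    deg : Vertex → ℕ
    deg = degree G

    deg≡degree : ∀ v → deg v ≡ degree G v
    deg≡degree v = refl

    position : Vertex → Edge → ℕ
    position v = rank (λ e → incidence G e v)

    position<deg : ∀ {e v} → Incident G e v → position v e < deg v
    position<deg {e} {v} i =
      subst (position v e <_) (sym (degree≡sum v)) (rank<sum (λ e → incidence G e v) (incidence≡1 i))

    position-injective : ∀ {e e' v} → Incident G e v → Incident G e' v →
                         position v e ≡ position v e' → e ≡ e'
    position-injective {v = v} i i' = rank-injective (λ e → incidence G e v) (incidence≡1 i) (incidence≡1 i')

    edge-at : ∀ {v p} → p < deg v → ∃ λ e → Incident G e v × position v e ≡ p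
    edge-at {v} p<
      with rank-surjective (λ e → incidence G e v) (incidence-binary v) (subst (_ <_) (degree≡sum v) p<)
    ... | e , incident , position≡p = e , incidence≡1⇒ incident , position≡p

module CyclicIntervalColouring (r' : ℕ) (G : Graph) (σ : Fin (n G) → Bool)
  (bipartite : ∀ e → σ (proj₁ (ends G e)) ≢ σ (proj₂ (ends G e)))
  (degree≤ : ∀ v → EdgePositions.deg G v ≤ suc (2 * r')) where

  open EdgePositions G

  r : ℕ
  r = suc r'

  source-incident : ∀ e → Incident G e (proj₁ (ends G e))
  source-incident e = inj₁ refl

  target-incident : ∀ e → Incident G e (proj₂ (ends G e))
  target-incident e = inj₂ refl

  -- Halving: the vertices of pair-ends are the pairs (v , g) of positions 2g, 2g + 1 at v.

  pair-ends : Edge → (Vertex × ℕ) × (Vertex × ℕ)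
  pair-ends e = (s , ⌊ position s e /2⌋) , (t , ⌊ position t e /2⌋)
    where
    s = proj₁ (ends G e)
    t = proj₂ (ends G e)

  touches-pair : ∀ {e v g} → Touches pair-ends e (v , g) → Incident G e v × ⌊ position v e /2⌋ ≡ g
  touches-pair {e} source = source-incident e , refl
  touches-pair {e} target = target-incident e , refl

  touches-pair⁺ : ∀ {e v} → Incident G e v → Touches pair-ends e (v , ⌊ position v e /2⌋)
  touches-pair⁺ (inj₁ refl) = source
  touches-pair⁺ (inj₂ refl) = target

  pair-slot : Vertex × ℕ → Edge → Fin 2
  pair-slot (v , _) e = lowBit (position v e)

  pair-slot-injective : ∀ {x e e'} → Touches pair-ends e x → Touches pair-ends e' x →
                        pair-slot x e ≡ pair-slot x e' → e ≡ e'
  pair-slot-injective {v , g} t t' same-bit with touches-pair t | touches-pair t'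
  ... | i , refl | i' , same-pair = position-injective i i' (⌊/2⌋-lowBit-injective (sym same-pair) same-bit)

  module Halving = Konig (Product.≡-dec _≟_ ℕ._≟_) _≟_ (allFin (m G)) ∈-allFin
                     pair-ends (σ ∘ proj₁) bipartite 2 pair-slot pair-slot-injective

  abstract
    half : Edge → Fin 2
    half = proj₁ Halving.konig

    half-proper : ProperEdgeColouring pair-ends half
    half-proper = proj₂ Halving.konig

  half-splits-pairs : ∀ {e e' v} → e ≢ e' → Incident G e v → Incident G e' v →
                      ⌊ position v e /2⌋ ≡ ⌊ position v e' /2⌋ → half e ≢ half e'
  half-splits-pairs {e' = e'} e≢e' i i' same-pair =
    half-proper e≢e' (touches-pair⁺ i)
                (subst (λ g → Touches pair-ends e' (_ , g)) (sym same-pair) (touches-pair⁺ i'))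

  -- Classes: every vertex v splits into its halves (v , 0) and (v , 1), and every slot
  -- j < r of v gets a dummy edge (v , j): a link between the two halves if pair j of v is
  -- absent, a pendant edge at the half without the last edge if pair j is unpaired, and
  -- an edge between two fresh vertices if pair j is complete. Every half then has exactly
  -- one edge in each slot.

  HalfVertex : Set
  HalfVertex = (Vertex × Fin 2) ⊎ (Vertex × Fin r × Bool)

  ClassEdge : Set
  ClassEdge = Edge ⊎ (Vertex × Fin r)

  -- the half of the edge in the last position at v (zero if v is isolated)
  last-half : Vertex → Fin 2
  last-half v with ℕ.pred (deg v) <? deg v
  ... | yes lt = half (proj₁ (edge-at lt))
  ... | no _   = zero

  last-half-spec : ∀ v {q} → deg v ≡ suc q →
                   ∃ λ e → Incident G e v × position v e ≡ q × half e ≡ last-half v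
  last-half-spec v d≡ with ℕ.pred (deg v) <? deg v
  ... | yes lt = proj₁ (edge-at lt) , proj₁ (proj₂ (edge-at lt)) ,
                 trans (proj₂ (proj₂ (edge-at lt))) (cong ℕ.pred d≡) , refl
  ... | no ¬lt = ⊥-elim (¬lt (subst (λ d → ℕ.pred d < d) (sym d≡) ≤-refl))

  halfSide : Bool → Fin 2 → Bool
  halfSide b zero       = b
  halfSide b (suc zero) = not b

  dummy-ends : ∀ v j → PairStatus (deg v) (toℕ j) → HalfVertex × HalfVertex
  dummy-ends v j (complete _) = inj₂ (v , j , false) , inj₂ (v , j , true)
  dummy-ends v j (unpaired _) = inj₁ (v , other (last-half v)) ,
                                inj₂ (v , j , not (halfSide (σ v) (other (last-half v))))
  dummy-ends v j (absent _)   = inj₁ (v , zero) , inj₁ (v , suc zero)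

  class-ends : ClassEdge → HalfVertex × HalfVertex
  class-ends (inj₁ e)       = inj₁ (proj₁ (ends G e) , half e) , inj₁ (proj₂ (ends G e) , half e)
  class-ends (inj₂ (v , j)) = dummy-ends v j (pair-status (deg v) (toℕ j))

  class-side : HalfVertex → Bool
  class-side (inj₁ (v , h))     = halfSide (σ v) h
  class-side (inj₂ (_ , _ , b)) = b

  class-bipartite : ∀ y → class-side (proj₁ (class-ends y)) ≢ class-side (proj₂ (class-ends y))
  class-bipartite (inj₁ e) with half e
  ... | zero     = bipartite e
  ... | suc zero = bipartite e ∘ not-injective
  class-bipartite (inj₂ (v , j)) with pair-status (deg v) (toℕ j)
  ... | complete _ = λ ()
  ... | unpaired _ = not-¬ refl
  ... | absent _   = not-¬ refl

  class-slot : HalfVertex → ClassEdge → Fin r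
  class-slot (inj₁ (v , _))     (inj₁ e)       = ⌊ position v e /2⌋ mod r
  class-slot _                  (inj₂ (_ , j)) = j
  class-slot (inj₂ (_ , j , _)) (inj₁ _)       = j

  touches-edge : ∀ {e v h} → Touches class-ends (inj₁ e) (inj₁ (v , h)) → Incident G e v × half e ≡ h
  touches-edge {e} source = source-incident e , refl
  touches-edge {e} target = target-incident e , refl

  touches-edge⁺ : ∀ {e v} → Incident G e v → Touches class-ends (inj₁ e) (inj₁ (v , half e))
  touches-edge⁺ (inj₁ refl) = source
  touches-edge⁺ (inj₂ refl) = target

  touches-edge-in : ∀ {e v h} → Incident G e v → half e ≡ h → Touches class-ends (inj₁ e) (inj₁ (v , h))
  touches-edge-in i refl = touches-edge⁺ i

  touches-edge-fresh : ∀ {e y} → ¬ Touches class-ends (inj₁ e) (inj₂ y)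
  touches-edge-fresh ()

  DummyAt : Vertex → Fin r → Fin 2 → Set
  DummyAt v j h = deg v ≤ 2 * toℕ j ⊎ (deg v ≡ suc (2 * toℕ j) × h ≡ other (last-half v))

  touches-dummy : ∀ {v' j v h} → Touches class-ends (inj₂ (v' , j)) (inj₁ (v , h)) → v' ≡ v × DummyAt v j h
  touches-dummy {v'} {j} t with pair-status (deg v') (toℕ j)
  touches-dummy source | unpaired d≡ = refl , inj₂ (d≡ , refl)
  touches-dummy source | absent d≤   = refl , inj₁ d≤
  touches-dummy target | absent d≤   = refl , inj₁ d≤

  touches-dummy-fresh : ∀ {v' j' v j b} → Touches class-ends (inj₂ (v' , j')) (inj₂ (v , j , b)) →
                        v' ≡ v × j' ≡ j
  touches-dummy-fresh {v'} {j'} t with pair-status (deg v') (toℕ j')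
  touches-dummy-fresh source | complete _ = refl , refl
  touches-dummy-fresh target | complete _ = refl , refl
  touches-dummy-fresh target | unpaired _ = refl , refl

  dummy-link : ∀ {v j} → deg v ≤ 2 * toℕ j → ∀ h → Touches class-ends (inj₂ (v , j)) (inj₁ (v , h))
  dummy-link {v} {j} d≤ h with pair-status (deg v) (toℕ j)
  dummy-link d≤ h          | complete lt = ⊥-elim (<-irrefl refl (≤-trans lt (≤-trans d≤ (n≤1+n _))))
  dummy-link d≤ h          | unpaired d≡ = ⊥-elim (<-irrefl refl (subst (_≤ _) d≡ d≤))
  dummy-link d≤ zero       | absent _    = source
  dummy-link d≤ (suc zero) | absent _    = target

  dummy-pendant : ∀ {v j} → deg v ≡ suc (2 * toℕ j) →
                  Touches class-ends (inj₂ (v , j)) (inj₁ (v , other (last-half v)))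
  dummy-pendant {v} {j} d≡ with pair-status (deg v) (toℕ j)
  ... | complete lt = ⊥-elim (<-irrefl refl (subst (_ <_) d≡ lt))
  ... | unpaired _  = source
  ... | absent d≤   = ⊥-elim (<-irrefl refl (subst (_≤ _) d≡ d≤))

  pair<r : ∀ {e v} → Incident G e v → ⌊ position v e /2⌋ < r
  pair<r {e} {v} i = s≤s (≤-trans (⌊n/2⌋-mono (≤-pred (≤-trans (position<deg i) (degree≤ v))))
                                  (≤-reflexive (⌊2*n/2⌋≡n r')))

  toℕ-mod : ∀ {x} → x < r → toℕ (x mod r) ≡ x
  toℕ-mod x<r = trans (toℕ-fromℕ< _) (m<n⇒m%n≡m x<r)

  mod-toℕ : ∀ (s : Fin r) → toℕ s mod r ≡ s
  mod-toℕ s = toℕ-injective (toℕ-mod (toℕ<n s))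

  edge-slot⇒pair : ∀ {e v s} → Incident G e v → ⌊ position v e /2⌋ mod r ≡ s →
                   ⌊ position v e /2⌋ ≡ toℕ s
  edge-slot⇒pair i slot≡s = trans (sym (toℕ-mod (pair<r i))) (cong toℕ slot≡s)

  pair⇒edge-slot : ∀ {s q} e v → position v e ≡ q → ⌊ q /2⌋ ≡ toℕ s → ⌊ position v e /2⌋ mod r ≡ s
  pair⇒edge-slot {s = s} _ _ refl pair≡ = trans (cong (_mod r) pair≡) (mod-toℕ s)

  edge-dummy-slots-differ : ∀ {e v h v' j} → Touches class-ends (inj₁ e) (inj₁ (v , h)) →
                            Touches class-ends (inj₂ (v' , j)) (inj₁ (v , h)) →
                            class-slot (inj₁ (v , h)) (inj₁ e) ≢ j
  edge-dummy-slots-differ {e} {v} t t' slot≡j with touches-edge t | touches-dummy t'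
  ... | i , refl | refl , status with 2*⌊/2⌋≤ (position v e) (edge-slot⇒pair i slot≡j) | status
  ...   | 2j≤q | inj₁ d≤2j = <-irrefl refl (<-≤-trans (position<deg i) (≤-trans d≤2j 2j≤q))
  ...   | 2j≤q | inj₂ (d≡ , h≡) with last-half-spec v d≡
  ...     | e* , i* , position≡ , half≡ = other≢ (last-half v) (trans (sym h≡) h≡')
    where
    position≡2j : position v e ≡ position v e*
    position≡2j =
      trans (≤-antisym (≤-pred (subst (position v e <_) d≡ (position<deg i))) 2j≤q) (sym position≡)
    h≡' : half e ≡ last-half v
    h≡' = trans (cong half (position-injective i i* position≡2j)) half≡

  class-slot-injective : ∀ {x y y'} → Touches class-ends y x → Touches class-ends y' x →
                         class-slot x y ≡ class-slot x y' → y ≡ y'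
  class-slot-injective {inj₁ _} {inj₁ e} {inj₁ e'} t t' slot≡ with touches-edge t | touches-edge t'
  ... | i , refl | i' , half≡ with e ≟ e'
  ...   | yes e≡e' = cong inj₁ e≡e'
  ...   | no e≢e'  = ⊥-elim (half-splits-pairs e≢e' i i'
                       (trans (edge-slot⇒pair i slot≡) (toℕ-mod (pair<r i'))) (sym half≡))
  class-slot-injective {inj₁ _} {inj₁ _} {inj₂ _} t t' slot≡ = ⊥-elim (edge-dummy-slots-differ t t' slot≡)
  class-slot-injective {inj₁ _} {inj₂ _} {inj₁ _} t t' slot≡ = ⊥-elim (edge-dummy-slots-differ t' t (sym slot≡))
  class-slot-injective {inj₁ _} {inj₂ _} {inj₂ _} t t' slot≡ with touches-dummy t | touches-dummy t'
  ... | refl , _ | refl , _ = cong (λ j → inj₂ (_ , j)) slot≡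
  class-slot-injective {inj₂ _} {inj₁ _} t = ⊥-elim (touches-edge-fresh t)
  class-slot-injective {inj₂ _} {inj₂ _} {inj₁ _} _ t' = ⊥-elim (touches-edge-fresh t')
  class-slot-injective {inj₂ _} {inj₂ _} {inj₂ _} t t' _ with touches-dummy-fresh t | touches-dummy-fresh t'
  ... | refl , refl | refl , refl = refl

  slot-used : ∀ v h (s : Fin r) →
              ∃ λ y → Touches class-ends y (inj₁ (v , h)) × class-slot (inj₁ (v , h)) y ≡ s
  slot-used v h s with pair-status (deg v) (toℕ s)
  ... | absent d≤ = inj₂ (v , s) , dummy-link d≤ h , refl
  ... | unpaired d≡ with h ≟ other (last-half v)
  ...   | yes refl = inj₂ (v , s) , dummy-pendant d≡ , refl
  ...   | no h≢ with last-half-spec v d≡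
  ...     | e , i , position≡ , half≡ =
              inj₁ e , touches-edge-in i (trans half≡ (sym (≢other⇒≡ (last-half v) h≢)))
                     , pair⇒edge-slot e v position≡ (⌊2*n/2⌋≡n (toℕ s))
  slot-used v h s | complete 2s+1<d with edge-at (≤-trans (n≤1+n _) 2s+1<d) | edge-at 2s+1<d
  ... | a , ia , pa | b , ib , pb with ≢⇒either (half-splits-pairs a≢b ia ib same-pair) h
    where
    a≢b : a ≢ b
    a≢b refl = <⇒≢ (n<1+n _) (trans (sym pa) pb)
    same-pair : ⌊ position v a /2⌋ ≡ ⌊ position v b /2⌋
    same-pair = trans (cong ⌊_/2⌋ pa)
                      (trans (⌊2*n/2⌋≡n (toℕ s)) (sym (trans (cong ⌊_/2⌋ pb) (⌊1+2*n/2⌋≡n (toℕ s)))))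
  ... | inj₁ refl = inj₁ a , touches-edge⁺ ia , pair⇒edge-slot a v pa (⌊2*n/2⌋≡n (toℕ s))
  ... | inj₂ refl = inj₁ b , touches-edge⁺ ib , pair⇒edge-slot b v pb (⌊1+2*n/2⌋≡n (toℕ s))

  class-edges : List ClassEdge
  class-edges = map inj₁ (allFin (m G)) ++ map inj₂ (cartesianProduct (allFin (n G)) (allFin r))

  ∈-class-edges : ∀ y → y ∈ class-edges
  ∈-class-edges (inj₁ e)       = ∈-++⁺ˡ (∈-map⁺ inj₁ (∈-allFin e))
  ∈-class-edges (inj₂ (v , j)) =
    ∈-++⁺ʳ (map inj₁ (allFin (m G))) (∈-map⁺ inj₂ (∈-cartesianProduct⁺ (∈-allFin v) (∈-allFin j)))

  _≟ʰ_ : (x x' : HalfVertex) → Dec (x ≡ x')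
  _≟ʰ_ = Sum.≡-dec (Product.≡-dec _≟_ _≟_) (Product.≡-dec _≟_ (Product.≡-dec _≟_ Bool._≟_))

  _≟ᶜ_ : (y y' : ClassEdge) → Dec (y ≡ y')
  _≟ᶜ_ = Sum.≡-dec _≟_ (Product.≡-dec _≟_ _≟_)

  module Classes = Konig _≟ʰ_ _≟ᶜ_ class-edges ∈-class-edges class-ends class-side class-bipartite
                     r class-slot class-slot-injective

  abstract
    κ : ClassEdge → Fin r
    κ = proj₁ Classes.konig

    κ-proper : ProperEdgeColouring class-ends κ
    κ-proper = proj₂ Classes.konig

  abstract
    -- The r edges in the r slots of a half have distinct classes, so all r classes occur.
    every-class-at-half : ∀ v h i → ∃ λ y → Touches class-ends y (inj₁ (v , h)) × κ y ≡ i
    every-class-at-half v h i with Fin-injective⇒surjective (κ ∘ in-slot) in-slot-injective i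
      where
      in-slot : Fin r → ClassEdge
      in-slot s = proj₁ (slot-used v h s)
      touches-in-slot : ∀ s → Touches class-ends (in-slot s) (inj₁ (v , h))
      touches-in-slot s = proj₁ (proj₂ (slot-used v h s))
      slot-of-in-slot : ∀ s → class-slot (inj₁ (v , h)) (in-slot s) ≡ s
      slot-of-in-slot s = proj₂ (proj₂ (slot-used v h s))
      in-slot-injective : ∀ {s s'} → κ (in-slot s) ≡ κ (in-slot s') → s ≡ s'
      in-slot-injective {s} {s'} κ≡ with in-slot s ≟ᶜ in-slot s'
      ... | yes y≡y' = trans (sym (slot-of-in-slot s))
                             (trans (cong (class-slot (inj₁ (v , h))) y≡y') (slot-of-in-slot s'))
      ... | no y≢y'  = ⊥-elim (κ-proper y≢y' (touches-in-slot s) (touches-in-slot s') κ≡)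
    ... | s , κ≡i = proj₁ (slot-used v h s) , proj₁ (proj₂ (slot-used v h s)) , κ≡i

  class : Edge → Fin r
  class e = κ (inj₁ e)

  class-differs-in-half : ∀ {e e' v} → e ≢ e' → Incident G e v → Incident G e' v → half e ≡ half e' →
                          class e ≢ class e'
  class-differs-in-half {e' = e'} e≢e' i i' half≡ =
    κ-proper (e≢e' ∘ Sum.inj₁-injective) (touches-edge⁺ i) (touches-edge-in i' (sym half≡))

  -- Bits: the edges of one class at v, at most one in each half, get different bits.

  bit-ends : Edge → (Vertex × Fin r) × (Vertex × Fin r)
  bit-ends e = (proj₁ (ends G e) , class e) , (proj₂ (ends G e) , class e)

  touches-bit : ∀ {e v i} → Touches bit-ends e (v , i) → Incident G e v × class e ≡ i
  touches-bit {e} source = source-incident e , refl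
  touches-bit {e} target = target-incident e , refl

  touches-bit⁺ : ∀ {e v} → Incident G e v → Touches bit-ends e (v , class e)
  touches-bit⁺ (inj₁ refl) = source
  touches-bit⁺ (inj₂ refl) = target

  bit-slot-injective : ∀ {x e e'} → Touches bit-ends e x → Touches bit-ends e' x → half e ≡ half e' → e ≡ e'
  bit-slot-injective {v , _} {e} {e'} t t' half≡ with touches-bit t | touches-bit t'
  ... | i , refl | i' , class≡ with e ≟ e'
  ...   | yes e≡e' = e≡e'
  ...   | no e≢e'  = ⊥-elim (class-differs-in-half e≢e' i i' half≡ (sym class≡))

  module Bits = Konig (Product.≡-dec _≟_ _≟_) _≟_ (allFin (m G)) ∈-allFin bit-ends (σ ∘ proj₁)
                  bipartite 2 (λ _ → half) bit-slot-injective

  abstract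
    bit : Edge → Fin 2
    bit = proj₁ Bits.konig

    bit-proper : ProperEdgeColouring bit-ends bit
    bit-proper = proj₂ Bits.konig

  bit-differs-in-class : ∀ {e e' v} → e ≢ e' → Incident G e v → Incident G e' v → class e ≡ class e' →
                         bit e ≢ bit e'
  bit-differs-in-class {e' = e'} e≢e' i i' class≡ =
    bit-proper e≢e' (touches-bit⁺ i)
               (subst (λ c → Touches bit-ends e' (_ , c)) (sym class≡) (touches-bit⁺ i'))

  -- The colouring: class i and bit b give colour 2 i + b + 1.

  colour : Fin r → Fin 2 → ℕ
  colour i b = suc (toℕ (combine i b))

  α : Edge → ℕ
  α e = colour (class e) (bit e)

  colour-injective : ∀ i b i' b' → colour i b ≡ colour i' b' → i ≡ i' × b ≡ b'
  colour-injective i b i' b' eq = combine-injective i b i' b' (toℕ-injective (suc-injective eq))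

  colour-range : ∀ i b → 1 ≤ colour i b × colour i b ≤ 2 * r
  colour-range i b = s≤s z≤n , subst (colour i b ≤_) (*-comm r 2) (toℕ<n (combine i b))

  colour-surjective : ∀ {c} → 1 ≤ c → c ≤ 2 * r → ∃₂ λ i b → colour i b ≡ c
  colour-surjective {suc c} _ c<2r with combine-surjective (fromℕ< (subst (c <_) (*-comm 2 r) c<2r))
  ... | i , b , combine≡ = i , b , cong suc (trans (cong toℕ combine≡) (toℕ-fromℕ< _))

  colour-suc : ∀ i → colour i (suc zero) ≡ suc (colour i zero)
  colour-suc i = cong suc (trans (toℕ-combine i (suc zero))
                                 (trans (+-suc (2 * toℕ i) 0) (cong suc (sym (toℕ-combine i zero)))))

  class-consecutive : ∀ {P : ℕ → Set} i → (∀ {c} → P c → ∃ λ b → colour i b ≡ c) → (∀ b → P (colour i b)) →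
                      Consecutive P
  class-consecutive {P} i only all = colour i zero , colour i (suc zero) , λ c → mk⇔ (to c) (from c)
    where
    lo≤hi : colour i zero ≤ colour i (suc zero)
    lo≤hi = ≤-trans (n≤1+n _) (≤-reflexive (sym (colour-suc i)))
    to : ∀ c → P c → colour i zero ≤ c × c ≤ colour i (suc zero)
    to c p with only p
    ... | zero     , refl = ≤-refl , lo≤hi
    ... | suc zero , refl = lo≤hi , ≤-refl
    from : ∀ c → colour i zero ≤ c × c ≤ colour i (suc zero) → P c
    from c (lo , hi) with m≤n⇒m<n∨m≡n lo
    ... | inj₂ refl = all zero
    ... | inj₁ lt   = subst P (≤-antisym (subst (_≤ c) (sym (colour-suc i)) lt) hi) (all (suc zero))

  single-consecutive : ∀ {P : ℕ → Set} c₀ → (∀ {c} → P c → c ≡ c₀) → P c₀ → Consecutive P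
  single-consecutive {P} c₀ only p₀ =
    c₀ , c₀ , λ c → mk⇔ (λ p → ≤-reflexive (sym (only p)) , ≤-reflexive (only p))
                        (λ (lo , hi) → subst P (≤-antisym lo hi) p₀)

  α-proper : ProperColoring G (2 * r) α
  α-proper = (λ e → colour-range (class e) (bit e)) ,
             λ { e e' (e≢e' , v , i , i') α≡ →
                 bit-differs-in-class e≢e' i i' (proj₁ (≡α α≡)) (proj₂ (≡α α≡)) }
    where
    ≡α : ∀ {e e'} → α e ≡ α e' → class e ≡ class e' × bit e ≡ bit e'
    ≡α {e} {e'} = colour-injective (class e) (bit e) (class e') (bit e')

  NoDummy : Vertex → Fin 2 → Fin r → Set
  NoDummy v h i = ∀ {v' j} → Touches class-ends (inj₂ (v' , j)) (inj₁ (v , h)) → κ (inj₂ (v' , j)) ≢ i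

  edge-of-class : ∀ v h i → NoDummy v h i → ∃ λ e → Incident G e v × half e ≡ h × class e ≡ i
  edge-of-class v h i no-dummy with every-class-at-half v h i
  ... | inj₁ e , t , κ≡i = e , proj₁ (touches-edge t) , proj₂ (touches-edge t) , κ≡i
  ... | inj₂ _ , t , κ≡i = ⊥-elim (no-dummy t κ≡i)

  both-colours : ∀ v i → (∀ h → NoDummy v h i) → ∀ b → S G α v (colour i b)
  both-colours v i no-dummy b
    with edge-of-class v zero i (no-dummy zero) | edge-of-class v (suc zero) i (no-dummy (suc zero))
  ... | e₀ , i₀ , half₀ , class₀ | e₁ , i₁ , half₁ , class₁
    with ≢⇒either (bit-differs-in-class e₀≢e₁ i₀ i₁ (trans class₀ (sym class₁))) b
    where
    e₀≢e₁ : e₀ ≢ e₁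
    e₀≢e₁ refl with () ← trans (sym half₀) half₁
  ... | inj₁ bit≡b = e₀ , i₀ , cong₂ colour class₀ bit≡b
  ... | inj₂ bit≡b = e₁ , i₁ , cong₂ colour class₁ bit≡b

  last : Fin r
  last = fromℕ r'

  r'≤⇒≡last : ∀ {j : Fin r} → r' ≤ toℕ j → j ≡ last
  r'≤⇒≡last {j} r'≤j = toℕ-injective (trans (≤-antisym (≤-pred (toℕ<n j)) r'≤j) (sym (toℕ-fromℕ r')))

  dummy-is-last : ∀ {v v' j h} → 2 * r' ≤ deg v → Touches class-ends (inj₂ (v' , j)) (inj₁ (v , h)) →
                  v' ≡ v × j ≡ last
  dummy-is-last {j = j} 2r'≤d t with touches-dummy t
  ... | refl , status = refl , r'≤⇒≡last (2*m≤1+2*n⇒m≤n (≤-trans 2r'≤d (dummy-bound status)))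
    where
    dummy-bound : ∀ {v h} → DummyAt v j h → deg v ≤ suc (2 * toℕ j)
    dummy-bound (inj₁ d≤2j)     = ≤-trans d≤2j (n≤1+n _)
    dummy-bound (inj₂ (d≡ , _)) = ≤-reflexive d≡

  degree-1 : ∀ v → deg v ≡ 1 → Consecutive (S G α v)
  degree-1 v d≡1 with edge-at {v} (subst (0 <_) (sym d≡1) (s≤s z≤n))
  ... | e₀ , i₀ , position≡ = single-consecutive (α e₀) only (e₀ , i₀ , refl)
    where
    only : ∀ {c} → S G α v c → c ≡ α e₀
    only (e , i , α≡c) = trans (sym α≡c) (cong α (position-injective i i₀
      (trans (n<1⇒n≡0 (subst (position v e <_) d≡1 (position<deg i))) (sym position≡))))

  degree-2 : ∀ v → deg v ≡ 2 → Consecutive (S G α v)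
  degree-2 v d≡2
    with edge-at {v} (subst (0 <_) (sym d≡2) (s≤s z≤n)) | edge-at {v} (subst (1 <_) (sym d≡2) ≤-refl)
  ... | e₀ , i₀ , position₀ | e₁ , i₁ , position₁ = class-consecutive (class e₀) only all
    where
    e₀≢e₁ : e₀ ≢ e₁
    e₀≢e₁ refl with () ← trans (sym position₀) position₁
    e₀-or-e₁ : ∀ {e} → Incident G e v → e ≡ e₀ ⊎ e ≡ e₁
    e₀-or-e₁ {e} i with position v e in eq | subst (position v e <_) d≡2 (position<deg i)
    ... | 0           | _ = inj₁ (position-injective i i₀ (trans eq (sym position₀)))
    ... | 1           | _ = inj₂ (position-injective i i₁ (trans eq (sym position₁)))
    ... | suc (suc _) | s≤s (s≤s ())
    half₀≢half₁ : half e₀ ≢ half e₁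
    half₀≢half₁ =
      half-splits-pairs e₀≢e₁ i₀ i₁ (trans (cong ⌊_/2⌋ position₀) (sym (cong ⌊_/2⌋ position₁)))
    -- the class of e₀ is present at the half of e₁, and only e₁ can carry it there
    class₁≡class₀ : class e₁ ≡ class e₀
    class₁≡class₀ with every-class-at-half v (half e₁) (class e₀)
    ... | inj₁ e , t , κ≡ with touches-edge t
    ...   | i , half≡ with e₀-or-e₁ i
    ...     | inj₁ refl = ⊥-elim (half₀≢half₁ half≡)
    ...     | inj₂ refl = κ≡
    class₁≡class₀ | inj₂ (_ , j) , t , κ≡ with touches-dummy t
    ... | refl , inj₁ d≤2j = ⊥-elim (κ-proper (λ ()) (dummy-link d≤2j (half e₀)) (touches-edge⁺ i₀) κ≡)
    ... | refl , inj₂ (d≡ , _) = ⊥-elim (even≢odd 1 (toℕ j) (trans (sym d≡2) d≡))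
    only : ∀ {c} → S G α v c → ∃ λ b → colour (class e₀) b ≡ c
    only (e , i , α≡c) with e₀-or-e₁ i
    ... | inj₁ refl = bit e₀ , α≡c
    ... | inj₂ refl = bit e₁ , trans (cong (λ i → colour i (bit e₁)) (sym class₁≡class₀)) α≡c
    all : ∀ b → S G α v (colour (class e₀) b)
    all b with ≢⇒either (bit-differs-in-class e₀≢e₁ i₀ i₁ (sym class₁≡class₀)) b
    ... | inj₁ refl = e₀ , i₀ , refl
    ... | inj₂ refl = e₁ , i₁ , cong (λ i → colour i (bit e₁)) class₁≡class₀

  last-dummy-class : Vertex → Fin r
  last-dummy-class v = κ (inj₂ (v , last))

  no-other-dummy : ∀ {v} → 2 * r' ≤ deg v → ∀ {i} → i ≢ last-dummy-class v → ∀ h → NoDummy v h i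
  no-other-dummy 2r'≤d i≢ h t κ≡i with dummy-is-last 2r'≤d t
  ... | refl , refl = i≢ (sym κ≡i)

  other-colours-present : ∀ {v} → 2 * r' ≤ deg v → ∀ {c} → 1 ≤ c → c ≤ 2 * r → ¬ S G α v c →
                          ∃ λ b → colour (last-dummy-class v) b ≡ c
  other-colours-present {v} 2r'≤d 1≤c c≤2r c∉S with colour-surjective 1≤c c≤2r
  ... | i , b , refl with i ≟ last-dummy-class v
  ...   | yes refl = b , refl
  ...   | no i≢    = ⊥-elim (c∉S (both-colours v i (no-other-dummy 2r'≤d i≢) b))

  degree-2r-2 : ∀ v → deg v ≡ 2 * r' → Consecutive (Complement (2 * r) (S G α v))
  degree-2r-2 v d≡ = class-consecutive (last-dummy-class v) only missing
    where
    only : ∀ {c} → Complement (2 * r) (S G α v) c → ∃ λ b → colour (last-dummy-class v) b ≡ c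
    only ((1≤c , c≤2r) , c∉S) = other-colours-present (≤-reflexive (sym d≡)) 1≤c c≤2r c∉S
    d≤2·last : deg v ≤ 2 * toℕ last
    d≤2·last = ≤-reflexive (trans d≡ (cong (2 *_) (sym (toℕ-fromℕ r'))))
    missing : ∀ b → Complement (2 * r) (S G α v) (colour (last-dummy-class v) b)
    missing b = colour-range (last-dummy-class v) b , λ (e , i , α≡) →
      κ-proper (λ ()) (touches-edge⁺ i) (dummy-link d≤2·last (half e))
               (proj₁ (colour-injective (class e) (bit e) (last-dummy-class v) b α≡))

  deg≡1+2·last : ∀ {v} → deg v ≡ suc (2 * r') → deg v ≡ suc (2 * toℕ last)
  deg≡1+2·last d≡ = trans d≡ (cong (λ x → suc (2 * x)) (sym (toℕ-fromℕ r')))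

  no-dummy-at-last-half : ∀ v → deg v ≡ suc (2 * r') → NoDummy v (last-half v) (last-dummy-class v)
  no-dummy-at-last-half v d≡ t _ with dummy-is-last (≤-trans (n≤1+n _) (≤-reflexive (sym d≡))) t | touches-dummy t
  ... | refl , refl | _ , inj₁ d≤2j        = <-irrefl refl (subst (_≤ _) (deg≡1+2·last d≡) d≤2j)
  ... | refl , refl | _ , inj₂ (_ , half≡) = other≢ (last-half v) (sym half≡)

  -- The class of the pendant dummy is carried in the other half by a single edge g.
  degree-2r-1 : ∀ v → deg v ≡ suc (2 * r') → Consecutive (Complement (2 * r) (S G α v))
  degree-2r-1 v d≡ with edge-of-class v (last-half v) (last-dummy-class v) (no-dummy-at-last-half v d≡)
  ... | g , g-incident , g-half , g-class = single-consecutive (colour j (other (bit g))) only missing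
    where
    j : Fin r
    j = last-dummy-class v
    only : ∀ {c} → Complement (2 * r) (S G α v) c → c ≡ colour j (other (bit g))
    only ((1≤c , c≤2r) , c∉S) with other-colours-present (≤-trans (n≤1+n _) (≤-reflexive (sym d≡))) 1≤c c≤2r c∉S
    ... | b , refl with b ≟ bit g
    ...   | yes refl = ⊥-elim (c∉S (g , g-incident , cong (λ i → colour i (bit g)) g-class))
    ...   | no b≢    = cong (colour j) (≢⇒other (bit g) b≢)
    not-present : ¬ S G α v (colour j (other (bit g)))
    not-present (e , i , α≡) with colour-injective (class e) (bit e) j (other (bit g)) α≡
    ... | class≡ , bit≡ with half e ≟ other (last-half v)
    ...   | yes half≡ = κ-proper (λ ()) (touches-edge-in i half≡) (dummy-pendant (deg≡1+2·last d≡)) class≡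
    ...   | no half≢ with e ≟ g
    ...     | yes refl = other≢ (bit g) (sym bit≡)
    ...     | no e≢g   = class-differs-in-half e≢g i g-incident
                           (trans (≢other⇒≡ (last-half v) half≢) (sym g-half)) (trans class≡ (sym g-class))
    missing : Complement (2 * r) (S G α v) (colour j (other (bit g)))
    missing = colour-range j (other (bit g)) , not-present

DegreeCase : ℕ → ℕ → Set
DegreeCase r' d = d ≡ 1 ⊎ d ≡ 2 ⊎ d ≡ 2 * r' ⊎ d ≡ suc (2 * r')

degree-case : ∀ {r' d} → d ≡ 1 ⊎ d ≡ 2 ⊎ d ≡ 2 * suc r' ∸ 2 ⊎ d ≡ 2 * suc r' ∸ 1 → DegreeCase r' d
degree-case {r'} = map⊎ (λ d≡ → d≡) (map⊎ (λ d≡ → d≡)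
                     (map⊎ (λ d≡ → trans d≡ (2*[1+n]∸2≡2*n r')) (λ d≡ → trans d≡ (2*[1+n]∸1≡1+2*n r'))))

DegreeCase⇒≤ : ∀ {r' d} → DegreeCase (suc r') d → d ≤ suc (2 * suc r')
DegreeCase⇒≤ (inj₁ refl)               = s≤s z≤n
DegreeCase⇒≤ (inj₂ (inj₁ refl))        = s≤s (s≤s z≤n)
DegreeCase⇒≤ (inj₂ (inj₂ (inj₁ refl))) = n≤1+n _
DegreeCase⇒≤ (inj₂ (inj₂ (inj₂ refl))) = ≤-refl

theorem2 : (r : ℕ) → 2 ≤ r → (G : Graph) → Bipartite G →
    ∃[ u ] (degree G u ≡ 2 * r ∸ 1) →
    ((v : Fin (n G)) → degree G v ≡ 1 ⊎ degree G v ≡ 2 ⊎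
      degree G v ≡ 2 * r ∸ 2 ⊎ degree G v ≡ 2 * r ∸ 1) →
    CyclicallyIntervalColorableWithin G (2 * r)
theorem2 (suc zero) (s≤s ()) _ _ _ _
theorem2 (suc (suc r'')) _ G (σ , bipartite) _ degrees =
  2 * r , s≤s z≤n , ≤-refl , α , α-proper , interval
  where
  open EdgePositions G
  cases : ∀ v → DegreeCase (suc r'') (deg v)
  cases v = subst (DegreeCase (suc r'')) (sym (deg≡degree v)) (degree-case {suc r''} (degrees v))
  open CyclicIntervalColouring (suc r'') G σ bipartite (DegreeCase⇒≤ ∘ cases)
  interval : ∀ v → Consecutive (S G α v) ⊎ Consecutive (Complement (2 * r) (S G α v))
  interval v with cases v
  ... | inj₁ d≡1              = inj₁ (degree-1 v d≡1)
  ... | inj₂ (inj₁ d≡2)       = inj₁ (degree-2 v d≡2)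
  ... | inj₂ (inj₂ (inj₁ d≡)) = inj₂ (degree-2r-2 v d≡)
  ... | inj₂ (inj₂ (inj₂ d≡)) = inj₂ (degree-2r-1 v d≡)
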